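{- Let $k,r$ be integers with $k\ge r\ge1$. For $m\ge1$, \[ g_{k,r}(m+1,\bar r)=q^r\sum_{s=1}^{r}g_{k,r}(m,s), \] and for $m\ge1$ and $j\ge1$, \[ g_{k,r}(m+1,\overline{kj+r})=q^{kj+r}\Bigl(g_{k,r}(m,\overline{k(j-1)+r})+\sum_{s=-k+r+1}^{r}g_{k,r}(m,kj+s)\Bigr). \]
   Context: Overpartitions: partitions in which the first occurrence of each part size may be overlined; parts are ordered $1<\bar1<2<\bar2<\cdots$ and listed non-increasingly. For $m\ge1$, $\mathcal{B}_{k,r}(m)$ is the set of overpartitions $\lambda=(\lambda_1,\ldots,\lambda_m)$ such that: only parts congruent to $r$ mod $k$ may be overlined; $\lambda_m\le\bar r$; and for $1\le i<m$ and every integer $j\ge0$, if $\overline{k(j-1)+r}\le\lambda_{i+1}\le kj+r$ then $\lambda_i\le\overline{kj+r}$ (for $j=0$ the lower bound is vacuous, i.e. $\lambda_{i+1}\le r$ implies $\lambda_i\le\bar r$). For $l$ a positive integer, $g_{k,r}(m,l)$ (resp. $g_{k,r}(m,\bar l)$) is $\sum q^{|\lambda|}$ over $\lambda\in\mathcal{B}_{k,r}(m)$ whose largest part $\lambda_1$ equals the non-overlined part $l$ (resp. the overlined part $\bar l$), where $|\lambda|$ is the sum of parts. -}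

module Defs where

open import Data.Bool using (Bool; true; false)
import Data.Bool.Properties as BoolP
open import Data.Nat using (ℕ; zero; suc; _+_; _*_; _∸_; _≤_; _<_; _≤?_; _<?_; z≤n; s≤s; ∣_-_∣)
open import Data.Nat.Properties using (_≟_; ≤-trans; <-≤-trans; m≤m+n; <-irrefl; ≤-refl; n≤1+n; +-assoc; ≤-reflexive)
open import Data.Nat.Divisibility using (_∣_; _∣?_)
open import Data.List using (List; []; _∷_; length; map; filter; concatMap; upTo; foldr)
open import Data.List.Relation.Unary.All using (All; all?)
open import Data.List.Relation.Unary.Linked using (Linked; linked?)
open import Data.Product using (_×_; _,_)
open import Data.Empty using (⊥; ⊥-elim)
open import Data.Unit using (⊤; tt)
open import Relation.Nullary using (Dec; yes; no; ¬_)
open import Relation.Nullary.Decidable using (_×-dec_; _→-dec_)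
open import Relation.Binary.PropositionalEquality using (_≡_; refl; cong; sym)

-- Overpartition parts.  part v false = v,  part v true = v̄ (overlined).
record OPart : Set where
  constructor part
  field
    val : ℕ
    ovl : Bool
open OPart public

-- Position in the total order 1 < 1̄ < 2 < 2̄ < ... :  v ↦ 2v, v̄ ↦ 2v+1.
key : OPart → ℕ
key (part v false) = 2 * v
key (part v true)  = suc (2 * v)

_≤ₒ_ : OPart → OPart → Set
a ≤ₒ b = key a ≤ key b

_<ₒ_ : OPart → OPart → Set
a <ₒ b = key a < key b

ov : ℕ → OPart
ov n = part n true

nv : ℕ → OPart
nv n = part n false

_≟ₚ_ : (a b : OPart) → Dec (a ≡ b)
part v b ≟ₚ part v′ b′ with v ≟ v′ | b BoolP.≟ b′
... | yes refl | yes refl = yes refl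
... | no ne    | _        = no λ { refl → ne refl }
... | yes _    | no ne    = no λ { refl → ne refl }

-- consecutive parts a = λᵢ, b = λᵢ₊₁ of an overpartition:
-- b ≤ a, and an overlined part cannot be repeated (only the first
-- occurrence of a part size may be overlined).
OvAdj : OPart → OPart → Set
OvAdj a b = (b ≤ₒ a) × (ovl b ≡ true → b <ₒ a)

Positive : OPart → Set
Positive p = 1 ≤ val p

IsOverpartition : List OPart → Set
IsOverpartition λs = All Positive λs × Linked OvAdj λs

module _ (k r : ℕ) where

  OvlCong : OPart → Set
  OvlCong p = ovl p ≡ true → k ∣ ∣ val p - r ∣

  -- for j ≥ 0:  lower bound  \overline{k(j-1)+r}  (vacuous for j = 0)
  --             upper bound  kj+r
  --             conclusion   λᵢ ≤ \overline{kj+r}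
  LowerOK : ℕ → OPart → Set
  LowerOK zero    b = ⊤
  LowerOK (suc j) b = ov (k * j + r) ≤ₒ b

  BCond : OPart → OPart → Set
  BCond a b = ∀ (j : ℕ) → LowerOK j b → b ≤ₒ nv (k * j + r) → a ≤ₒ ov (k * j + r)

  LastLe : List OPart → Set
  LastLe []           = ⊤
  LastLe (x ∷ [])     = x ≤ₒ ov r
  LastLe (x ∷ y ∷ ys) = LastLe (y ∷ ys)

  InB : ℕ → List OPart → Set
  InB m λs = (length λs ≡ m)
           × IsOverpartition λs
           × All OvlCong λs
           × LastLe λs
           × Linked BCond λs

decBounded : {P : ℕ → Set} → (∀ j → Dec (P j)) → (N : ℕ) →
             (∀ j → N < j → P j) → Dec (∀ j → P j)
decBounded {P} P? zero vac with P? 0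
... | no ¬p = no λ f → ¬p (f 0)
... | yes p = yes λ { zero → p ; (suc j) → vac (suc j) (s≤s z≤n) }
decBounded {P} P? (suc N) vac with P? 0 | decBounded {λ j → P (suc j)} (λ j → P? (suc j)) N (λ j N<j → vac (suc j) (s≤s N<j))
... | no ¬p | _      = no λ f → ¬p (f 0)
... | yes _ | no ¬f  = no λ f → ¬f (λ j → f (suc j))
... | yes p | yes f  = yes λ { zero → p ; (suc j) → f j }

grow : ∀ r k′ j′ → j′ ≤ 2 * (suc k′ * j′ + r)
grow r k′ j′ = ≤-trans (m≤m+n j′ (k′ * j′ + r))
                (≤-trans (≤-reflexive (sym (+-assoc j′ (k′ * j′) r)))
                         (m≤m+n (suc k′ * j′ + r) (suc k′ * j′ + r + 0)))

vacGen : ∀ k r a b j → suc (key b) < j → LowerOK k r j b → b ≤ₒ nv (k * j + r) → a ≤ₒ ov (k * j + r)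
vacGen zero     r a b (suc j′) (s≤s kb<j′) lo hi = ⊥-elim (<-irrefl refl (<-≤-trans lo hi))
vacGen (suc k′) r a b (suc j′) (s≤s kb<j′) lo hi =
  ⊥-elim (<-irrefl refl (<-≤-trans (≤-trans (s≤s (grow r k′ j′)) lo) (≤-trans (n≤1+n _) kb<j′)))

module _ (k r : ℕ) where

  private
    LowerOK? : ∀ j b → Dec (LowerOK k r j b)
    LowerOK? zero    b = yes tt
    LowerOK? (suc j) b = key (ov (k * j + r)) ≤? key b

    P? : ∀ a b j → Dec (LowerOK k r j b → b ≤ₒ nv (k * j + r) → a ≤ₒ ov (k * j + r))
    P? a b j = LowerOK? j b →-dec ((key b ≤? key (nv (k * j + r))) →-dec (key a ≤? key (ov (k * j + r))))

    vac : ∀ a b j → suc (key b) < j → LowerOK k r j b → b ≤ₒ nv (k * j + r) → a ≤ₒ ov (k * j + r)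
    vac = vacGen k r

  BCond? : ∀ a b → Dec (BCond k r a b)
  BCond? a b = decBounded (P? a b) (suc (key b)) (vac a b)

  LastLe? : ∀ λs → Dec (LastLe k r λs)
  LastLe? []           = yes tt
  LastLe? (x ∷ [])     = key x ≤? key (ov r)
  LastLe? (x ∷ y ∷ ys) = LastLe? (y ∷ ys)

  InB? : ∀ m λs → Dec (InB k r m λs)
  InB? m λs =
    (length λs ≟ m) ×-dec
    ((all? (λ p → 1 ≤? val p) λs ×-dec
      linked? (λ a b → (key b ≤? key a) ×-dec ((ovl b BoolP.≟ true) →-dec (key b <? key a))) λs) ×-dec
    (all? (λ p → (ovl p BoolP.≟ true) →-dec (k ∣? ∣ val p - r ∣)) λs ×-dec
    (LastLe? λs ×-dec
    linked? BCond? λs)))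

-- Formal power series in q with ℕ coefficients: Series = coefficient map.

Series : Set
Series = ℕ → ℕ

_⊕_ : Series → Series → Series
(f ⊕ g) n = f n + g n

zeroS : Series
zeroS _ = 0

qPow* : ℕ → Series → Series
qPow* zero    f n       = f n
qPow* (suc a) f zero    = 0
qPow* (suc a) f (suc n) = qPow* a f n

-- Σ_{t=a}^{b} f t   (empty when b < a)
ΣS : ℕ → ℕ → (ℕ → Series) → Series
ΣS a b f = foldr (λ t acc → f t ⊕ acc) zeroS (map (a +_) (upTo (suc b ∸ a)))

weight : List OPart → ℕ
weight = foldr (λ p acc → val p + acc) 0

IsHead : OPart → List OPart → Set
IsHead l []      = ⊥
IsHead l (x ∷ _) = x ≡ l

IsHead? : ∀ l λs → Dec (IsHead l λs)
IsHead? l []      = no λ ()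
IsHead? l (x ∷ _) = x ≟ₚ l

listsOf : {A : Set} → ℕ → List A → List (List A)
listsOf zero    xs = [] ∷ []
listsOf (suc m) xs = concatMap (λ x → map (x ∷_) (listsOf m xs)) xs

-- all parts whose value is ≤ v (every part of an overpartition with
-- largest part l has value ≤ val l)
partsUpTo : ℕ → List OPart
partsUpTo v = concatMap (λ i → part i false ∷ part i true ∷ []) (upTo (suc v))

g : (k r m : ℕ) → OPart → Series
g k r m l n = length (filter (λ λs → InB? k r m λs ×-dec (IsHead? l λs ×-dec (weight λs ≟ n)))
                             (listsOf m (partsUpTo (val l))))

-- Deleting the largest part l from λ ∈ B_{k,r}(m+1) leaves an element of B_{k,r}(m)
-- whose largest part y can follow l, and conversely; so g(m+1,l) = q^|l| Σ_y g(m,y)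
-- over the possible successors y of l.  For l = r̄ these are 1, …, r (an overlined
-- y < r would need k ∣ r - y, impossible as r ≤ k).  For l = \overline{kj+r} the
-- condition on consecutive parts, taken at j-1, forces y > k(j-1)+r, and since only
-- parts congruent to r mod k are overlined, y is \overline{k(j-1)+r} or one of
-- kj+r-k+1, …, kj+r.
module Submission where

open import Defs
open import Data.Bool using (true; false)
open import Data.Empty using (⊥-elim)
open import Data.List using (List; []; _∷_; [_]; _++_; map; concatMap; filter; length; foldr; upTo)
open import Data.List.Properties using (applyUpTo-∷ʳ; concatMap-++; map-++; map-∘)
open import Data.List.Membership.Propositional using (_∈_)
open import Data.List.Membership.Propositional.Properties using (∈-map⁺; ∈-map⁻; ∈-upTo⁺; ∈-upTo⁻)
open import Data.List.Relation.Unary.All as All using (All; []; _∷_)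
import Data.List.Relation.Unary.All.Properties as All
open import Data.List.Relation.Unary.Any using (Any; here; there)
open import Data.List.Relation.Unary.Linked as Linked using (_∷_)
open import Data.List.Relation.Unary.Linked.Properties using (Linked⇒All)
open import Data.List.Relation.Unary.Unique.Propositional using (Unique; []; _∷_)
open import Data.List.Relation.Unary.Unique.Propositional.Properties using (upTo⁺)
import Data.List.Relation.Unary.Unique.Propositional.Properties as Unique
open import Data.Nat using (ℕ; zero; suc; _+_; _*_; _∸_; _≤_; _<_; _≤?_; z≤n; s≤s; z<s; ∣_-_∣; NonZero; >-nonZero; >-nonZero⁻¹)
open import Data.Nat.ListAction using (sum)
open import Data.Nat.ListAction.Properties using (sum-++)
open import Data.Nat.Properties
open import Data.Nat.Tactic.RingSolver using (solve-∀)
open import Data.Nat.Divisibility using (_∣_; _∣0; ∣⇒≤; ∣m+n∣m⇒∣n; m∣m*n)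
open import Data.Product using (_×_; _,_; proj₁; proj₂)
open import Data.Sum using (inj₁; inj₂)
open import Data.Unit using (tt)
open import Function using (_∘_)
open import Relation.Binary.PropositionalEquality using (_≡_; _≢_; refl; sym; trans; cong; cong₂; subst; ≢-sym; module ≡-Reasoning)
open import Relation.Nullary using (Dec; yes; no; ¬_)
open import Relation.Nullary.Decidable using (_×-dec_)

private
  variable
    A B : Set

∑ : List A → (A → ℕ) → ℕ
∑ xs f = sum (map f xs)

syntax ∑ xs (λ x → e) = ∑[ x ∈ xs ] e

∑-cong : (xs : List A) {f h : A → ℕ} → (∀ {x} → x ∈ xs → f x ≡ h x) → ∑ xs f ≡ ∑ xs h
∑-cong []       eq = refl
∑-cong (x ∷ xs) eq = cong₂ _+_ (eq (here refl)) (∑-cong xs (eq ∘ there))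

∑-zero : (xs : List A) {f : A → ℕ} → (∀ {x} → x ∈ xs → f x ≡ 0) → ∑ xs f ≡ 0
∑-zero []       eq = refl
∑-zero (x ∷ xs) eq = cong₂ _+_ (eq (here refl)) (∑-zero xs (eq ∘ there))

∑-++ : (xs ys : List A) (f : A → ℕ) → ∑ (xs ++ ys) f ≡ ∑ xs f + ∑ ys f
∑-++ xs ys f = trans (cong sum (map-++ f xs ys)) (sum-++ (map f xs) (map f ys))

∑-map : (h : A → B) (xs : List A) (f : B → ℕ) → ∑ (map h xs) f ≡ ∑ xs (f ∘ h)
∑-map h xs f = cong sum (sym (map-∘ xs))

∑-concatMap : (h : A → List B) (xs : List A) (f : B → ℕ) →
              ∑ (concatMap h xs) f ≡ ∑[ x ∈ xs ] ∑ (h x) f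
∑-concatMap h []       f = refl
∑-concatMap h (x ∷ xs) f = trans (∑-++ (h x) (concatMap h xs) f) (cong (∑ (h x) f +_) (∑-concatMap h xs f))

∑-+ : (xs : List A) (f h : A → ℕ) → ∑[ x ∈ xs ] (f x + h x) ≡ ∑ xs f + ∑ xs h
∑-+ []       f h = refl
∑-+ (x ∷ xs) f h = trans (cong (f x + h x +_) (∑-+ xs f h)) (+-+-exchange (f x) (h x) _ _)
  where
  +-+-exchange : ∀ a b c d → (a + b) + (c + d) ≡ (a + c) + (b + d)
  +-+-exchange = solve-∀

∑-comm : (xs : List A) (ys : List B) (F : A → B → ℕ) →
         ∑[ x ∈ xs ] ∑[ y ∈ ys ] F x y ≡ ∑[ y ∈ ys ] ∑[ x ∈ xs ] F x y
∑-comm []       ys F = sym (∑-zero ys (λ _ → refl))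
∑-comm (x ∷ xs) ys F = trans (cong (∑ ys (F x) +_) (∑-comm xs ys F)) (sym (∑-+ ys (F x) _))

∑-single : {xs : List A} {a : A} (f : A → ℕ) → Unique xs → a ∈ xs →
           (∀ {x} → x ≢ a → f x ≡ 0) → ∑ xs f ≡ f a
∑-single {xs = x ∷ xs} f (x∉xs ∷ _) (here refl) off =
  trans (cong (f x +_) (∑-zero xs (λ x′∈xs → off (≢-sym (All.lookup x∉xs x′∈xs))))) (+-identityʳ _)
∑-single {xs = x ∷ xs} f (x∉xs ∷ u) (there a∈xs) off =
  cong₂ _+_ (off (All.lookup x∉xs a∈xs)) (∑-single f u a∈xs off)

𝟙 : {P : Set} → Dec P → ℕ
𝟙 (yes _) = 1
𝟙 (no _)  = 0

𝟙-yes : {P : Set} → P → (d : Dec P) → 𝟙 d ≡ 1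
𝟙-yes p (yes _) = refl
𝟙-yes p (no ¬p) = ⊥-elim (¬p p)

𝟙-no : {P : Set} → ¬ P → (d : Dec P) → 𝟙 d ≡ 0
𝟙-no ¬p (yes p) = ⊥-elim (¬p p)
𝟙-no ¬p (no _)  = refl

length-filter≡∑𝟙 : {P : A → Set} (P? : ∀ x → Dec (P x)) (xs : List A) →
                   length (filter P? xs) ≡ ∑[ x ∈ xs ] 𝟙 (P? x)
length-filter≡∑𝟙 P? []       = refl
length-filter≡∑𝟙 P? (x ∷ xs) with P? x
... | yes _ = cong suc (length-filter≡∑𝟙 P? xs)
... | no _  = length-filter≡∑𝟙 P? xs

∑-listsOf-suc : (m : ℕ) (xs : List A) (f : List A → ℕ) →
                ∑ (listsOf (suc m) xs) f ≡ ∑[ x ∈ xs ] ∑[ ys ∈ listsOf m xs ] f (x ∷ ys)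
∑-listsOf-suc m xs f = trans (∑-concatMap (λ x → map (x ∷_) (listsOf m xs)) xs f)
                             (∑-cong xs (λ {x} _ → ∑-map (x ∷_) (listsOf m xs) f))

∑-listsOf-++ : (Q : A → Set) (m : ℕ) (xs es : List A) (f : List A → ℕ) → All Q es →
               (∀ L → Any Q L → f L ≡ 0) → ∑ (listsOf m (xs ++ es)) f ≡ ∑ (listsOf m xs) f
∑-listsOf-++ Q zero    xs es f Qes off = refl
∑-listsOf-++ Q (suc m) xs es f Qes off = begin
  ∑ (listsOf (suc m) (xs ++ es)) f
    ≡⟨ ∑-listsOf-suc m (xs ++ es) f ⟩
  ∑[ x ∈ xs ++ es ] ∑[ ys ∈ listsOf m (xs ++ es) ] f (x ∷ ys)
    ≡⟨ ∑-++ xs es _ ⟩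
  ∑[ x ∈ xs ] ∑[ ys ∈ listsOf m (xs ++ es) ] f (x ∷ ys) + ∑[ e ∈ es ] ∑[ ys ∈ listsOf m (xs ++ es) ] f (e ∷ ys)
    ≡⟨ cong₂ _+_ (∑-cong xs (λ {x} _ → ∑-listsOf-++ Q m xs es (f ∘ (x ∷_)) Qes (λ L q → off (x ∷ L) (there q))))
                 (∑-zero es (λ {e} e∈es → ∑-zero (listsOf m (xs ++ es))
                                                 (λ {ys} _ → off (e ∷ ys) (here (All.lookup Qes e∈es))))) ⟩
  ∑[ x ∈ xs ] ∑[ ys ∈ listsOf m xs ] f (x ∷ ys) + 0
    ≡⟨ +-identityʳ _ ⟩
  ∑[ x ∈ xs ] ∑[ ys ∈ listsOf m xs ] f (x ∷ ys)
    ≡⟨ ∑-listsOf-suc m xs f ⟨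
  ∑ (listsOf (suc m) xs) f ∎
  where open ≡-Reasoning

partsUpTo-suc : ∀ v → partsUpTo (suc v) ≡ partsUpTo v ++ nv (suc v) ∷ ov (suc v) ∷ []
partsUpTo-suc v = trans (cong (concatMap (λ i → nv i ∷ ov i ∷ [])) (sym (applyUpTo-∷ʳ (λ i → i) (suc v))))
                        (concatMap-++ (λ i → nv i ∷ ov i ∷ []) (upTo (suc v)) [ suc v ])

∑-listsOf-partsUpTo-mono : ∀ {s v} m (f : List OPart → ℕ) → s ≤ v →
                           (∀ L → Any (λ p → s < val p) L → f L ≡ 0) →
                           ∑ (listsOf m (partsUpTo v)) f ≡ ∑ (listsOf m (partsUpTo s)) f
∑-listsOf-partsUpTo-mono {v = zero}  m f z≤n off = refl
∑-listsOf-partsUpTo-mono {s} {suc v} m f s≤v off with m≤n⇒m<n∨m≡n s≤v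
... | inj₂ refl = refl
... | inj₁ s<1+v = begin
  ∑ (listsOf m (partsUpTo (suc v))) f
    ≡⟨ cong (λ ps → ∑ (listsOf m ps) f) (partsUpTo-suc v) ⟩
  ∑ (listsOf m (partsUpTo v ++ nv (suc v) ∷ ov (suc v) ∷ [])) f
    ≡⟨ ∑-listsOf-++ _ m (partsUpTo v) _ f (s<1+v ∷ s<1+v ∷ []) off ⟩
  ∑ (listsOf m (partsUpTo v)) f
    ≡⟨ ∑-listsOf-partsUpTo-mono m f (m<1+n⇒m≤n s<1+v) off ⟩
  ∑ (listsOf m (partsUpTo s)) f ∎
  where open ≡-Reasoning

∑-partsUpTo-single : ∀ {v} {l : OPart} (F : OPart → ℕ) → val l ≤ v →
                     (∀ {x} → x ≢ l → F x ≡ 0) → ∑ (partsUpTo v) F ≡ F l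
∑-partsUpTo-single {v} {part w b} F w≤v off = begin
  ∑ (partsUpTo v) F
    ≡⟨ ∑-concatMap (λ i → nv i ∷ ov i ∷ []) (upTo (suc v)) F ⟩
  ∑[ i ∈ upTo (suc v) ] (F (nv i) + (F (ov i) + 0))
    ≡⟨ ∑-single _ (upTo⁺ (suc v)) (∈-upTo⁺ (s≤s w≤v))
                (λ i≢w → cong₂ _+_ (off (i≢w ∘ cong val)) (cong (_+ 0) (off (i≢w ∘ cong val)))) ⟩
  F (nv w) + (F (ov w) + 0)
    ≡⟨ pair b off ⟩
  F (part w b) ∎
  where
  open ≡-Reasoning
  pair : ∀ b → (∀ {x} → x ≢ part w b → F x ≡ 0) → F (nv w) + (F (ov w) + 0) ≡ F (part w b)
  pair false off′ = trans (cong (λ z → F (nv w) + (z + 0)) (off′ (λ ()))) (+-identityʳ _)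
  pair true  off′ = trans (cong (_+ (F (ov w) + 0)) (off′ (λ ()))) (+-identityʳ _)

ov≤ₒov : ∀ {a b} → a ≤ b → ov a ≤ₒ ov b
ov≤ₒov a≤b = s≤s (*-monoʳ-≤ 2 a≤b)

nv≤ₒov : ∀ {a b} → a ≤ b → nv a ≤ₒ ov b
nv≤ₒov a≤b = m≤n⇒m≤1+n (*-monoʳ-≤ 2 a≤b)

ov<ₒov : ∀ {a b} → a < b → ov a <ₒ ov b
ov<ₒov a<b = s≤s (*-monoʳ-< 2 a<b)

nv<ₒnv : ∀ {a b} → a < b → nv a <ₒ nv b
nv<ₒnv = *-monoʳ-< 2

nv<ₒov : ∀ {a b} → a ≤ b → nv a <ₒ ov b
nv<ₒov a≤b = s≤s (*-monoʳ-≤ 2 a≤b)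

nv<ₒnv⁻¹ : ∀ {a b} → nv a <ₒ nv b → a < b
nv<ₒnv⁻¹ = *-cancelˡ-< 2 _ _

ov<ₒov⁻¹ : ∀ {a b} → ov a <ₒ ov b → a < b
ov<ₒov⁻¹ (s≤s 2a<2b) = *-cancelˡ-< 2 _ _ 2a<2b

nv<ₒov⁻¹ : ∀ {a b} → nv a <ₒ ov b → a ≤ b
nv<ₒov⁻¹ (s≤s 2a≤2b) = *-cancelˡ-≤ 2 2a≤2b

val-mono : ∀ {p q} → p ≤ₒ q → val p ≤ val q
val-mono {p} {q} p≤q = ≮⇒≥ (λ q<p → <⇒≱ (key-< q<p) p≤q)
  where
  2*val≤key : ∀ x → 2 * val x ≤ key x
  2*val≤key (part _ false) = ≤-refl
  2*val≤key (part _ true)  = n≤1+n _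
  key≤1+2*val : ∀ x → key x ≤ suc (2 * val x)
  key≤1+2*val (part _ false) = n≤1+n _
  key≤1+2*val (part _ true)  = ≤-refl
  key-< : val q < val p → key q < key p
  key-< q<p = begin-strict
    key q                  ≤⟨ key≤1+2*val q ⟩
    suc (2 * val q)        <⟨ n<1+n _ ⟩
    2 + 2 * val q          ≡⟨ *-suc 2 (val q) ⟨
    2 * suc (val q)        ≤⟨ *-monoʳ-≤ 2 q<p ⟩
    2 * val p              ≤⟨ 2*val≤key p ⟩
    key p                  ∎
    where open ≤-Reasoning

∣∧<⇒≡0 : ∀ {k d} → k ∣ d → d < k → d ≡ 0
∣∧<⇒≡0 {d = zero}  _   _   = refl
∣∧<⇒≡0 {d = suc _} k∣d d<k = ⊥-elim (<⇒≱ d<k (∣⇒≤ k∣d))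

ovlCong-window : ∀ {k r j v} → k ∣ ∣ v - r ∣ → k * j + r ≤ v → v < k * suc j + r → v ≡ k * j + r
ovlCong-window {k} {r} {j} k∣∣v-r∣ W≤v v<V with m≤n⇒∃[o]m+o≡n W≤v
... | d , refl = trans (cong (k * j + r +_) d≡0) (+-identityʳ _)
  where
  ∣v-r∣≡ : ∣ k * j + r + d - r ∣ ≡ k * j + d
  ∣v-r∣≡ = trans (cong (∣_- r ∣) (shuffle (k * j) r d)) (trans (∣-∣-comm (r + (k * j + d)) r) (∣m-m+n∣≡n r _))
    where
    shuffle : ∀ a r d → a + r + d ≡ r + (a + d)
    shuffle = solve-∀
  d<k : d < k
  d<k = +-cancelˡ-< (k * j + r) d k (subst (k * j + r + d <_) (V≡ k j r) v<V)
    where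
    V≡ : ∀ k j r → k * suc j + r ≡ k * j + r + k
    V≡ = solve-∀
  d≡0 : d ≡ 0
  d≡0 = ∣∧<⇒≡0 (∣m+n∣m⇒∣n (subst (k ∣_) ∣v-r∣≡ k∣∣v-r∣) (m∣m*n j)) d<k

ovlCong-below : ∀ {k r v} → 1 ≤ v → v < r → r ≤ k → ¬ (k ∣ ∣ v - r ∣)
ovlCong-below {k} {r} {v} 1≤v v<r r≤k k∣∣v-r∣ =
  <⇒≢ (m<n⇒0<n∸m v<r) (sym (∣∧<⇒≡0 (subst (k ∣_) (m≤n⇒∣m-n∣≡n∸m (<⇒≤ v<r)) k∣∣v-r∣) r∸v<k))
  where
  r∸v<k : r ∸ v < k
  r∸v<k = <-≤-trans (∸-monoʳ-< {r} {v} {0} 1≤v (<⇒≤ v<r)) r≤k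

≡-qPow* : ∀ a (F f : Series) → (∀ n → F (a + n) ≡ f n) → (∀ n → n < a → F n ≡ 0) → ∀ n → F n ≡ qPow* a f n
≡-qPow* zero    F f shifted below n       = shifted n
≡-qPow* (suc a) F f shifted below zero    = below zero z<s
≡-qPow* (suc a) F f shifted below (suc n) =
  ≡-qPow* a (F ∘ suc) f shifted (λ n n<a → below (suc n) (s≤s n<a)) n

interval : ℕ → ℕ → List ℕ
interval a b = map (a +_) (upTo (suc b ∸ a))

ΣS-at : ∀ a b (F : ℕ → Series) n → ΣS a b F n ≡ ∑[ t ∈ interval a b ] F t n
ΣS-at a b F n = foldr-⊕-at (interval a b)
  where
  foldr-⊕-at : ∀ ts → foldr (λ t acc → F t ⊕ acc) zeroS ts n ≡ ∑[ t ∈ ts ] F t n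
  foldr-⊕-at []       = refl
  foldr-⊕-at (t ∷ ts) = cong (F t n +_) (foldr-⊕-at ts)

interval-unique : ∀ a b → Unique (interval a b)
interval-unique a b = Unique.map⁺ (+-cancelˡ-≡ a _ _) (upTo⁺ (suc b ∸ a))

∈-interval⁺ : ∀ {a b t} → a ≤ t → t ≤ b → t ∈ interval a b
∈-interval⁺ {a} {b} {t} a≤t t≤b =
  subst (_∈ interval a b) (m+[n∸m]≡n a≤t) (∈-map⁺ (a +_) (∈-upTo⁺ (∸-monoˡ-< (s≤s t≤b) a≤t)))

∈-interval⁻ : ∀ {a b t} → t ∈ interval a b → a ≤ t × t ≤ b
∈-interval⁻ {a} {b} t∈ with ∈-map⁻ (a +_) t∈
... | i , i∈ , refl = m≤m+n a i , m<1+n⇒m≤n a+i<1+b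
  where
  a+i<1+b : a + i < suc b
  a+i<1+b with a ≤? suc b
  ... | yes a≤1+b = subst (a + i <_) (m+[n∸m]≡n a≤1+b) (+-monoʳ-< a (∈-upTo⁻ i∈))
  ... | no a≰1+b  = ⊥-elim (n≮0 (subst (i <_) (m≤n⇒m∸n≡0 (<⇒≤ (≰⇒> a≰1+b))) (∈-upTo⁻ i∈)))

Extends : (k r : ℕ) → OPart → OPart → Set
Extends k r l y = Positive l × OvAdj l y × OvlCong k r l × BCond k r l y

module _ {k r : ℕ} where

  InB-∷∷⁻ : ∀ {m l y ys} → InB k r (suc m) (l ∷ y ∷ ys) → InB k r m (y ∷ ys) × Extends k r l y
  InB-∷∷⁻ (len , (pl ∷ ps , adj ∷ lk) , ocl ∷ ocs , last , bc ∷ bcs) =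
    (suc-injective len , (ps , lk) , ocs , last , bcs) , pl , adj , ocl , bc

  InB-∷∷⁺ : ∀ {m l y ys} → InB k r m (y ∷ ys) → Extends k r l y → InB k r (suc m) (l ∷ y ∷ ys)
  InB-∷∷⁺ (len , (ps , lk) , ocs , last , bcs) (pl , adj , ocl , bc) =
    (cong suc len , (pl ∷ ps , adj ∷ lk) , ocl ∷ ocs , last , bc ∷ bcs)

  InB-head-max : ∀ {m x xs} → InB k r m (x ∷ xs) → All (λ p → val p ≤ val x) (x ∷ xs)
  InB-head-max {x = x} (_ , (_ , lk) , _) = All.map (λ {p} → val-mono {p} {x}) below-x
    where
    below-x : All (_≤ₒ x) (x ∷ _)
    below-x = Linked⇒All {R = λ a b → b ≤ₒ a} (λ b≤a c≤b → ≤-trans c≤b b≤a) {v = x} ≤-refl (Linked.map proj₁ lk)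

  InB-no-part-above-head : ∀ {m h L} → InB k r m L → IsHead h L → ¬ Any (λ p → val h < val p) L
  InB-no-part-above-head {L = x ∷ xs} inb refl above =
    All.lookupWith (λ p≤x x<p → <⇒≱ x<p p≤x) (InB-head-max inb) above

  -- Induction on i: either b is already below the previous threshold, or it lies above
  -- ov (k * (i - 1) + r), which is exactly the lower bound BCond asks for.
  BCond-unbounded-below : ∀ {a b} → BCond k r a b → ∀ i → b ≤ₒ nv (k * i + r) → a ≤ₒ ov (k * i + r)
  BCond-unbounded-below bc zero    b≤ = bc zero tt b≤
  BCond-unbounded-below {a} {b} bc (suc i) b≤ with key b ≤? key (nv (k * i + r))
  ... | yes b≤′ = ≤-trans (BCond-unbounded-below {a} {b} bc i b≤′)
                          (ov≤ₒov (+-monoˡ-≤ r (*-monoʳ-≤ k (n≤1+n i))))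
  ... | no b≰   = bc (suc i) (≰⇒> b≰) b≤

  BCond-ov-r : ∀ {y} → BCond k r (ov r) y
  BCond-ov-r j _ _ = ov≤ₒov (m≤n+m r (k * j))

  BCond-ov⁻ : ∀ {j y} .{{_ : NonZero k}} → BCond k r (ov (k * suc j + r)) y → nv (k * j + r) <ₒ y
  BCond-ov⁻ {j} {y} bc with key y ≤? key (nv (k * j + r))
  ... | no y≰  = ≰⇒> y≰
  ... | yes y≤ = ⊥-elim (<⇒≱ W<V (val-mono {ov V} {ov W} (BCond-unbounded-below {ov V} {y} bc j y≤)))
    where
    V W : ℕ
    V = k * suc j + r
    W = k * j + r
    W<V : W < V
    W<V = +-monoˡ-< r (*-monoʳ-< k (n<1+n j))

  BCond-ov⁺ : ∀ {j y} → nv (k * j + r) <ₒ y → BCond k r (ov (k * suc j + r)) y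
  BCond-ov⁺ {j} W<y i _ y≤ = ov≤ₒov (+-monoˡ-≤ r (*-monoʳ-≤ k j<i))
    where
    j<i : suc j ≤ i
    j<i = *-cancelˡ-< k j i (+-cancelʳ-< r (k * j) (k * i) (nv<ₒnv⁻¹ (<-≤-trans W<y y≤)))

  OvlCong-ov-r : OvlCong k r (ov r)
  OvlCong-ov-r _ = subst (k ∣_) (sym (∣n-n∣≡0 r)) (k ∣0)

  OvlCong-ov : ∀ {j} → OvlCong k r (ov (k * j + r))
  OvlCong-ov {j} _ = subst (k ∣_) (sym ∣kj+r-r∣≡kj) (m∣m*n j)
    where
    ∣kj+r-r∣≡kj : ∣ k * j + r - r ∣ ≡ k * j
    ∣kj+r-r∣≡kj = trans (m≤n⇒∣n-m∣≡n∸m (m≤n+m r (k * j))) (m+n∸n≡m (k * j) r)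

  successor-≤ : ∀ {l y} → Extends k r l y → val y ≤ val l
  successor-≤ {l} {y} (_ , (y≤l , _) , _) = val-mono {y} {l} y≤l

  Counted : ℕ → OPart → ℕ → List OPart → Set
  Counted m l n L = InB k r m L × (IsHead l L × weight L ≡ n)

  counted? : ∀ m l n L → Dec (Counted m l n L)
  counted? m l n L = InB? k r m L ×-dec (IsHead? l L ×-dec (weight L ≟ n))

  χ : ℕ → OPart → ℕ → List OPart → ℕ
  χ m l n L = 𝟙 (counted? m l n L)

  g≡∑χ : ∀ m l n → g k r m l n ≡ ∑[ L ∈ listsOf m (partsUpTo (val l)) ] χ m l n L
  g≡∑χ m l n = length-filter≡∑𝟙 (counted? m l n) (listsOf m (partsUpTo (val l)))

  g-over-partsUpTo : ∀ {v} m l n → val l ≤ v → g k r m l n ≡ ∑[ L ∈ listsOf m (partsUpTo v) ] χ m l n L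
  g-over-partsUpTo m l n l≤v = trans (g≡∑χ m l n) (sym (∑-listsOf-partsUpTo-mono m (χ m l n) l≤v above-head))
    where
    above-head : ∀ L → Any (λ p → val l < val p) L → χ m l n L ≡ 0
    above-head L above = 𝟙-no (λ (inb , hd , _) → InB-no-part-above-head inb hd above) (counted? m l n L)

  g-suc≡∑χ-∷ : ∀ m l n → g k r (suc m) l n ≡ ∑[ ys ∈ listsOf m (partsUpTo (val l)) ] χ (suc m) l n (l ∷ ys)
  g-suc≡∑χ-∷ m l n = begin
    g k r (suc m) l n
      ≡⟨ g≡∑χ (suc m) l n ⟩
    ∑ (listsOf (suc m) (partsUpTo (val l))) (χ (suc m) l n)
      ≡⟨ ∑-listsOf-suc m (partsUpTo (val l)) _ ⟩
    ∑[ x ∈ partsUpTo (val l) ] ∑[ ys ∈ listsOf m (partsUpTo (val l)) ] χ (suc m) l n (x ∷ ys)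
      ≡⟨ ∑-partsUpTo-single _ ≤-refl other-heads ⟩
    ∑[ ys ∈ listsOf m (partsUpTo (val l)) ] χ (suc m) l n (l ∷ ys) ∎
    where
    open ≡-Reasoning
    other-heads : ∀ {x} → x ≢ l → ∑[ ys ∈ listsOf m (partsUpTo (val l)) ] χ (suc m) l n (x ∷ ys) ≡ 0
    other-heads {x} x≢l = ∑-zero (listsOf m (partsUpTo (val l)))
                                 (λ {ys} _ → 𝟙-no (λ (_ , x≡l , _) → x≢l x≡l) (counted? (suc m) l n (x ∷ ys)))

  -- complete only needs to handle y that can occur as a part of an element of B_{k,r}.
  record Successors (l : OPart) (A : List OPart) : Set where
    field
      unique   : Unique A
      sound    : ∀ {y} → y ∈ A → Extends k r l y
      complete : ∀ {y} → Positive y → OvlCong k r y → Extends k r l y → y ∈ A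

  module _ {l A} (S : Successors l A) where
    open Successors S

    χ-∷ : ∀ {m} → 1 ≤ m → ∀ n ys → χ (suc m) l (val l + n) (l ∷ ys) ≡ ∑[ a ∈ A ] χ m a n ys
    χ-∷ {suc m} (s≤s z≤n) n [] =
      trans (𝟙-no (λ { ((() , _) , _) }) (counted? (suc (suc m)) l (val l + n) (l ∷ [])))
            (sym (∑-zero A (λ {a} _ → 𝟙-no (λ { (_ , () , _) }) (counted? (suc m) a n []))))
    χ-∷ {m} m≥1 n (y ∷ ys) with counted? (suc m) l (val l + n) (l ∷ y ∷ ys)
    ... | yes (inb , _ , wt) = sym (begin
      ∑[ a ∈ A ] χ m a n (y ∷ ys)
        ≡⟨ ∑-single _ unique y∈A (λ a≢y → 𝟙-no (λ (_ , y≡a , _) → a≢y (sym y≡a)) (counted? m _ n (y ∷ ys))) ⟩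
      χ m y n (y ∷ ys)
        ≡⟨ 𝟙-yes (inb′ , refl , +-cancelˡ-≡ (val l) _ _ wt) (counted? m y n (y ∷ ys)) ⟩
      1 ∎)
      where
      open ≡-Reasoning
      inb′ : InB k r m (y ∷ ys)
      inb′ = proj₁ (InB-∷∷⁻ inb)
      y∈A : y ∈ A
      y∈A with inb′
      ... | _ , (py ∷ _ , _) , ocy ∷ _ , _ = complete py ocy (proj₂ (InB-∷∷⁻ inb))
    ... | no ¬c = sym (∑-zero A (λ {a} a∈A → 𝟙-no (not-counted a∈A) (counted? m a n (y ∷ ys))))
      where
      not-counted : ∀ {a} → a ∈ A → ¬ Counted m a n (y ∷ ys)
      not-counted a∈A (inb′ , refl , wt) = ¬c (InB-∷∷⁺ inb′ (sound a∈A) , refl , cong (val l +_) wt)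

    g-∷ : ∀ {m} → 1 ≤ m → ∀ n → g k r (suc m) l (val l + n) ≡ ∑[ a ∈ A ] g k r m a n
    g-∷ {m} m≥1 n = begin
      g k r (suc m) l (val l + n)
        ≡⟨ g-suc≡∑χ-∷ m l (val l + n) ⟩
      ∑[ ys ∈ listsOf m (partsUpTo (val l)) ] χ (suc m) l (val l + n) (l ∷ ys)
        ≡⟨ ∑-cong (listsOf m (partsUpTo (val l))) (λ {ys} _ → χ-∷ m≥1 n ys) ⟩
      ∑[ ys ∈ listsOf m (partsUpTo (val l)) ] ∑[ a ∈ A ] χ m a n ys
        ≡⟨ ∑-comm (listsOf m (partsUpTo (val l))) A _ ⟩
      ∑[ a ∈ A ] ∑[ ys ∈ listsOf m (partsUpTo (val l)) ] χ m a n ys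
        ≡⟨ ∑-cong A (λ {a} a∈A → g-over-partsUpTo m a n (successor-≤ (sound a∈A))) ⟨
      ∑[ a ∈ A ] g k r m a n ∎
      where open ≡-Reasoning

  g-suc-below-head : ∀ {m l n} → n < val l → g k r (suc m) l n ≡ 0
  g-suc-below-head {m} {l} {n} n<l =
    trans (g-suc≡∑χ-∷ m l n)
          (∑-zero (listsOf m (partsUpTo (val l))) (λ {ys} _ → 𝟙-no too-heavy (counted? (suc m) l n (l ∷ ys))))
    where
    too-heavy : ∀ {ys} → ¬ Counted (suc m) l n (l ∷ ys)
    too-heavy (_ , _ , wt) = <⇒≱ n<l (subst (val l ≤_) wt (m≤m+n (val l) _))

  successors-ov-r : 1 ≤ r → r ≤ k → Successors (ov r) (map nv (interval 1 r))
  successors-ov-r r≥1 r≤k = record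
    { unique   = Unique.map⁺ (cong val) (interval-unique 1 r)
    ; sound    = sound
    ; complete = complete
    }
    where
    sound : ∀ {y} → y ∈ map nv (interval 1 r) → Extends k r (ov r) y
    sound y∈ with ∈-map⁻ nv y∈
    ... | t , t∈ , refl = r≥1 , (nv≤ₒov (proj₂ (∈-interval⁻ t∈)) , λ ()) , OvlCong-ov-r , BCond-ov-r
    complete : ∀ {y} → Positive y → OvlCong k r y → Extends k r (ov r) y → y ∈ map nv (interval 1 r)
    complete {part v false} v≥1 _  (_ , (v≤r , _) , _) = ∈-map⁺ nv (∈-interval⁺ v≥1 (val-mono {nv v} {ov r} v≤r))
    complete {part v true}  v≥1 oc (_ , (_ , v<r) , _) = ⊥-elim (ovlCong-below v≥1 (ov<ₒov⁻¹ (v<r refl)) r≤k (oc refl))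

  successors-ov : ∀ {j} .{{_ : NonZero k}} →
    Successors (ov (k * suc j + r)) (ov (k * j + r) ∷ map nv (interval (k * suc j + r + 1 ∸ k) (k * suc j + r)))
  successors-ov {j} = record
    { unique   = All.map⁺ (All.tabulate (λ _ ())) ∷ Unique.map⁺ (cong val) (interval-unique _ _)
    ; sound    = sound
    ; complete = complete
    }
    where
    V W : ℕ
    V = k * suc j + r
    W = k * j + r
    W<V : W < V
    W<V = +-monoˡ-< r (*-monoʳ-< k (n<1+n j))
    V+1∸k≡1+W : V + 1 ∸ k ≡ suc W
    V+1∸k≡1+W = trans (cong (_∸ k) (reassoc k j r)) (m+n∸m≡n k (suc W))
      where
      reassoc : ∀ k j r → k * suc j + r + 1 ≡ k + suc (k * j + r)
      reassoc = solve-∀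
    V≥1 : Positive (ov V)
    V≥1 = ≤-trans (>-nonZero⁻¹ k) (≤-trans (m≤m*n k (suc j)) (m≤m+n _ r))
    sound : ∀ {y} → y ∈ ov W ∷ map nv (interval (V + 1 ∸ k) V) → Extends k r (ov V) y
    sound (here refl) = V≥1 , (ov≤ₒov (<⇒≤ W<V) , λ _ → ov<ₒov W<V) , OvlCong-ov , BCond-ov⁺ (nv<ₒov {W} ≤-refl)
    sound (there y∈) with ∈-map⁻ nv y∈
    ... | t , t∈ , refl with ∈-interval⁻ t∈
    ... | lo , t≤V = V≥1 , (nv≤ₒov t≤V , λ ()) , OvlCong-ov , BCond-ov⁺ (nv<ₒnv (subst (_≤ t) V+1∸k≡1+W lo))
    complete : ∀ {y} → Positive y → OvlCong k r y → Extends k r (ov V) y → y ∈ ov W ∷ map nv (interval (V + 1 ∸ k) V)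
    complete {part v false} _ _ (_ , (v≤V , _) , _ , bc) =
      there (∈-map⁺ nv (∈-interval⁺ (subst (_≤ v) (sym V+1∸k≡1+W) (nv<ₒnv⁻¹ (BCond-ov⁻ bc)))
                                    (val-mono {nv v} {ov V} v≤V)))
    complete {part v true} _ oc (_ , (_ , v<V) , _ , bc) =
      here (cong ov (ovlCong-window (oc refl) (nv<ₒov⁻¹ (BCond-ov⁻ bc)) (ov<ₒov⁻¹ (v<V refl))))

lemma4p5 : ∀ (k r : ℕ) → 1 ≤ r → r ≤ k →
    (∀ (m : ℕ) → 1 ≤ m → ∀ (n : ℕ) →
       g k r (suc m) (ov r) n ≡ qPow* r (ΣS 1 r (λ s → g k r m (nv s))) n)
    × (∀ (m : ℕ) → 1 ≤ m → ∀ (j : ℕ) → 1 ≤ j → ∀ (n : ℕ) →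
       g k r (suc m) (ov (k * j + r)) n
         ≡ qPow* (k * j + r)
             (g k r m (ov (k * (j ∸ 1) + r))
              ⊕ ΣS (k * j + r + 1 ∸ k) (k * j + r) (λ t → g k r m (nv t))) n)
lemma4p5 k r r≥1 r≤k = recurrence-ov-r , recurrence-ov
  where
  instance
    k≢0 : NonZero k
    k≢0 = >-nonZero (≤-trans r≥1 r≤k)

  recurrence-ov-r : ∀ m → 1 ≤ m → ∀ n → g k r (suc m) (ov r) n ≡ qPow* r (ΣS 1 r (λ s → g k r m (nv s))) n
  recurrence-ov-r m m≥1 = ≡-qPow* r _ _ shifted (λ _ → g-suc-below-head {k} {r} {m} {ov r})
    where
    shifted : ∀ n → g k r (suc m) (ov r) (r + n) ≡ ΣS 1 r (λ s → g k r m (nv s)) n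
    shifted n = begin
      g k r (suc m) (ov r) (r + n)                    ≡⟨ g-∷ (successors-ov-r r≥1 r≤k) m≥1 n ⟩
      ∑[ a ∈ map nv (interval 1 r) ] g k r m a n      ≡⟨ ∑-map nv (interval 1 r) _ ⟩
      ∑[ s ∈ interval 1 r ] g k r m (nv s) n          ≡⟨ ΣS-at 1 r _ n ⟨
      ΣS 1 r (λ s → g k r m (nv s)) n                 ∎
      where open ≡-Reasoning

  recurrence-ov : ∀ m → 1 ≤ m → ∀ j → 1 ≤ j → ∀ n →
    g k r (suc m) (ov (k * j + r)) n
      ≡ qPow* (k * j + r) (g k r m (ov (k * (j ∸ 1) + r)) ⊕ ΣS (k * j + r + 1 ∸ k) (k * j + r) (λ t → g k r m (nv t))) n
  recurrence-ov m m≥1 (suc j) _ = ≡-qPow* V _ _ shifted (λ _ → g-suc-below-head {k} {r} {m} {ov V})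
    where
    V = k * suc j + r
    shifted : ∀ n → g k r (suc m) (ov V) (V + n) ≡ g k r m (ov (k * j + r)) n + ΣS (V + 1 ∸ k) V (λ t → g k r m (nv t)) n
    shifted n = trans (g-∷ successors-ov m≥1 n)
                      (cong (g k r m (ov (k * j + r)) n +_) (trans (∑-map nv I _) (sym (ΣS-at (V + 1 ∸ k) V _ n))))
      where
      I = interval (V + 1 ∸ k) V
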